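{- Let $\Gamma$ be a method specification, $\mathcal{C}$ a client, $\sigma\in\Sigma$, and let $(l,H)$, $(l',H')$ be pairs with $H$ balanced from $l$ and $H'$ balanced from $l'$ such that $(l,H)\sqsubseteq(l',H')$. If $\Gamma\vdash\mathcal{C}$ is safe at $\sigma$, then for every $\kappa\in[\![\Gamma\vdash\mathcal{C}]\!]\sigma$ such that $\delta(\sigma)\circ l$ is defined and $\mathsf{history}(\kappa)=H$, there exists $\kappa'\in[\![\Gamma\vdash\mathcal{C}]\!]\sigma$ with $\mathsf{history}(\kappa')=H'$ and $\kappa\sim\kappa'$.
   Context: Separation algebra: a set $\Sigma$ with a partial commutative, associative (both sides defined and equal or both undefined), cancellative binary operation $*$ with unit $e$; $(\sigma_1*\sigma_2)\downarrow$ means defined; $\sigma_2\setminus\sigma_1$ is the unique $\sigma$ with $\sigma_2=\sigma*\sigma_1$. Footprint $\delta(\sigma)=\{\sigma'\mid\forall\sigma''.(\sigma'*\sigma'')\downarrow\iff(\sigma*\sigma'')\downarrow\}$; $\delta(\sigma_1)\circ\delta(\sigma_2)=\delta(\sigma_1*\sigma_2)$ if defined, undefined otherwise. Standing assumption: $*$ is cancellative on footprints. $l_2\mathbin{\backslash\!\backslash}l_1=\delta(\sigma)$ if $l_1=\delta(\sigma_1),l_2=\delta(\sigma_2),\sigma_2=\sigma_1*\sigma$; $l_1\preceq l_2$ iff $l_2\mathbin{\backslash\!\backslash}l_1$ defined. Histories: finite sequences of interface actions $(t,\mathsf{call}\,m(\sigma))$, $(t,\mathsf{ret}\,m(\sigma))$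 (per thread alternating calls/returns of matching methods starting with a call). Balanced from $l$: $[\![\varepsilon]\!]^\sharp l=l$, $[\![H\psi]\!]^\sharp l=([\![H]\!]^\sharp l)\circ\delta(\sigma)$ (call carrying $\sigma$) or $([\![H]\!]^\sharp l)\mathbin{\backslash\!\backslash}\delta(\sigma)$ (return carrying $\sigma$) is defined. $H\sqsubseteq H'$ iff there is a bijection $\rho$ of positions with $H(i)=H'(\rho(i))$ and, for $i<j$ with $H(i),H(j)$ by the same thread or $H(i)$ a return and $H(j)$ a call, $\rho(i)<\rho(j)$. $(l,H)\sqsubseteq(l',H')$ iff $l'\preceq l$ and $H\sqsubseteq H'$. Primitive commands have transformers $f^t_c:\Sigma\to\mathcal{P}(\Sigma)\cup\{\top\}$ satisfying Footprint Preservation ($\sigma'\in f^t_c(\sigma)\Rightarrow\delta(\sigma')=\delta(\sigma)$) and Strong Locality ($(\sigma_1*\sigma_2)\downarrow$, $f^t_c(\sigma_1)\ne\top$ imply $f^t_c(\sigma_1*\sigma_2)=\{\sigma'*\sigma_2\mid\sigma'\in f^t_c(\sigma_1)\}$). A client is $\mathcal{C}=\mathsf{let}\ [-]\ \mathsf{in}\ C_1\|\cdots\|C_n$ with $C::=c\mid m\mid C;C\mid C+C\mid C^*$. Precise predicate $r$: each $\sigma$ has at most one $\sigma_1\in r$ with $\sigma=\sigma_1*\sigma_2$; $\sigma\setminus r=\sigma_2$. A method specification $\Gamma$: triples $\{p\}m\{q\}$ (at most one per method) with $p,q$ maps from threads $t$ to precise predicates; $\Gamma\vdash\mathcal{C}$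 means $\mathcal{C}$ calls only methods specified in $\Gamma$. Client-local semantics: trace set of $\Gamma\vdash\mathcal{C}$ is the prefix closure of the set of interleavings (actions only by threads $1..n$) whose projection to thread $t$ is generated by $C_t$ via $[c]_t=\{(t,c)\}$, $[m]_t=\{(t,\mathsf{call}\,m)(t,\mathsf{ret}\,m)\}$, union for $+$, concatenation for $;$, Kleene star for ${}^*$. Evaluation: $(t,c)$ gives $\top$ if $f^t_c(\sigma)=\top$ else $\{(\sigma',(t,c))\mid\sigma'\in f^t_c(\sigma)\}$; for $\{p\}m\{q\}\in\Gamma$, $(t,\mathsf{call}\,m)$ gives $\top$ if $\sigma\setminus p_t$ undefined, else $\{(\sigma\setminus p_t,(t,\mathsf{call}\,m(\sigma_p)))\}$ with $\sigma_p\in p_t$ the unique substate; $(t,\mathsf{ret}\,m)$ gives $\{(\sigma*\sigma_q,(t,\mathsf{ret}\,m(\sigma_q)))\mid\sigma_q\in q_t,(\sigma*\sigma_q)\downarrow\}$. Traces are evaluated step by step ($\top$ if any step from a reachable state faults). $[\![\Gamma\vdash\mathcal{C}]\!]\sigma=\top$ if some trace evaluates to $\top$ from $\sigma$, else the set of resulting annotated traces; safe at $\sigma$ iff $\ne\top$. $\mathsf{history}(\kappa)$ = subsequence of call/return actions. $\kappa\sim\kappa'$ iff $\kappa|_t=\kappa'|_t$ for every thread $t$ and the projections of $\kappa,\kappa'$ to non-interface actions coincide. -}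

module Defs where

open import Level using (0ℓ)
open import Data.Nat using (ℕ; zero; suc; _≟_)
open import Data.Fin using (Fin; toℕ) renaming (_<_ to _<ᶠ_)
open import Data.List using (List; []; _∷_; _++_; length; lookup)
open import Data.List.Relation.Unary.All using (All)
open import Data.Maybe using (Maybe; just; nothing; _>>=_)
open import Data.Product using (Σ; Σ-syntax; ∃; ∃-syntax; _×_; _,_; proj₁)
open import Data.Sum using (_⊎_)
open import Data.Empty using (⊥)
open import Data.Unit using (⊤)
open import Relation.Nullary using (¬_; yes; no)
open import Relation.Binary.PropositionalEquality using (_≡_)
open import Function.Bundles using (_⇔_; _⤖_; Bijection)

record SepAlg : Set₁ where
  field
    St      : Set
    _*_     : St → St → Maybe St
    e       : St
    *-comm  : ∀ a b → a * b ≡ b * a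
    *-assoc : ∀ a b c → (a * b >>= λ ab → ab * c) ≡ (b * c >>= λ bc → a * bc)
    *-unit  : ∀ a → e * a ≡ just a
    *-cancel : ∀ a b b' c → a * b ≡ just c → a * b' ≡ just c → b ≡ b'

module FpDefs (SA : SepAlg) where
  open SepAlg SA

  Defined : Maybe St → Set
  Defined x = ∃ λ y → x ≡ just y

  -- σ' ≈δ σ  iff  σ' ∈ δ(σ) ;  footprints δ(σ) are exactly the ≈δ-classes,
  -- and a footprint is represented by any of its elements.
  _≈δ_ : St → St → Set
  σ' ≈δ σ = ∀ σ'' → Defined (σ' * σ'') ⇔ Defined (σ * σ'')

  -- δ(a) ∘ δ(b) = δ(c)
  Comp : St → St → St → Set
  Comp a b c = ∃ λ d → (a * b ≡ just d) × (d ≈δ c)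

  -- δ(l₂) \\ δ(l₁) = δ(r)
  Sub : St → St → St → Set
  Sub l₂ l₁ r = ∃ λ σ₁ → ∃ λ σ₂ → ∃ λ σ →
    (σ₁ ≈δ l₁) × (σ₂ ≈δ l₂) × (σ₁ * σ ≡ just σ₂) × (σ ≈δ r)

  _⪯_ : St → St → Set
  l₁ ⪯ l₂ = ∃ λ r → Sub l₂ l₁ r

  FpCancellative : Set
  FpCancellative = ∀ σ₁ σ σ' a b → σ₁ * σ ≡ just a → σ₁ * σ' ≡ just b →
    a ≈δ b → σ ≈δ σ'

-- results of a primitive transformer: a set of states, or ⊤ (fault)
data Res (A : Set) : Set₁ where
  fault : Res A
  ok    : (A → Set) → Res A

record Setting : Set₁ where
  field
    SA : SepAlg
  open SepAlg SA
  open FpDefs SA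
  field
    fp-cancel : FpCancellative
    Method : Set
    Cmd    : Set
    f      : ℕ → Cmd → St → Res St
    footprint-preservation : ∀ t c σ P σ' → f t c σ ≡ ok P → P σ' → σ' ≈δ σ
    strong-locality : ∀ t c σ₁ σ₂ σ P → σ₁ * σ₂ ≡ just σ → f t c σ₁ ≡ ok P →
      Σ[ Q ∈ (St → Set) ] (f t c σ ≡ ok Q) ×
        (∀ σ' → Q σ' ⇔ (∃ λ σ'' → P σ'' × (σ'' * σ₂ ≡ just σ')))

module Sem (S : Setting) where
  open Setting S
  open SepAlg SA
  open FpDefs SA

  Pred : Set₁
  Pred = St → Set

  Precise : Pred → Set
  Precise r = ∀ {σ a a' b b'} → r a → r a' → a * b ≡ just σ → a' * b' ≡ just σ → a ≡ a'

  record Triple : Set₁ where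
    field
      p q : ℕ → Pred
      p-precise : ∀ t → Precise (p t)
      q-precise : ∀ t → Precise (q t)
  open Triple

  MSpec : Set₁
  MSpec = Method → Maybe Triple

  data Com : Set where
    prim  : Cmd → Com
    mcall : Method → Com
    _⨾_   : Com → Com → Com
    _⊕_   : Com → Com → Com
    _⋆    : Com → Com

  -- client  let [-] in C₁ ∥ ⋯ ∥ Cₙ ; thread t = toℕ i + 1 runs body i
  record Client : Set where
    field
      n    : ℕ
      body : Fin n → Com
  open Client

  data Calls : Com → Method → Set where
    c-call : ∀ {m} → Calls (mcall m) m
    c-seqˡ : ∀ {C₁ C₂ m} → Calls C₁ m → Calls (C₁ ⨾ C₂) m
    c-seqʳ : ∀ {C₁ C₂ m} → Calls C₂ m → Calls (C₁ ⨾ C₂) m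
    c-chˡ  : ∀ {C₁ C₂ m} → Calls C₁ m → Calls (C₁ ⊕ C₂) m
    c-chʳ  : ∀ {C₁ C₂ m} → Calls C₂ m → Calls (C₁ ⊕ C₂) m
    c-star : ∀ {C m} → Calls C m → Calls (C ⋆) m

  _⊢_ : MSpec → Client → Set₁
  Γ ⊢ cl = ∀ i m → Calls (body cl i) m → ∃ λ (s : Triple) → Γ m ≡ just s

  data Lab : Set where
    lc    : Cmd → Lab
    lcall : Method → Lab
    lret  : Method → Lab

  Act : Set
  Act = ℕ × Lab

  data Gen : Com → List Lab → Set where
    g-prim : ∀ {c} → Gen (prim c) (lc c ∷ [])
    g-call : ∀ {m} → Gen (mcall m) (lcall m ∷ lret m ∷ [])
    g-seq  : ∀ {C₁ C₂ w₁ w₂} → Gen C₁ w₁ → Gen C₂ w₂ → Gen (C₁ ⨾ C₂) (w₁ ++ w₂)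
    g-chˡ  : ∀ {C₁ C₂ w} → Gen C₁ w → Gen (C₁ ⊕ C₂) w
    g-chʳ  : ∀ {C₁ C₂ w} → Gen C₂ w → Gen (C₁ ⊕ C₂) w
    g-nil  : ∀ {C} → Gen (C ⋆) []
    g-cons : ∀ {C w₁ w₂} → Gen C w₁ → Gen (C ⋆) w₂ → Gen (C ⋆) (w₁ ++ w₂)

  projL : ℕ → List Act → List Lab
  projL t [] = []
  projL t ((t' , x) ∷ τ) with t ≟ t'
  ... | yes _ = x ∷ projL t τ
  ... | no  _ = projL t τ

  Interleaving : Client → List Act → Set
  Interleaving cl τ =
    All (λ a → ∃ λ (i : Fin (n cl)) → proj₁ a ≡ suc (toℕ i)) τ ×
    (∀ (i : Fin (n cl)) → Gen (body cl i) (projL (suc (toℕ i)) τ))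

  Traces : Client → List Act → Set
  Traces cl τ = ∃ λ τ' → Interleaving cl (τ ++ τ')

  data ALab : Set where
    acmd  : Cmd → ALab
    acall : Method → St → ALab
    aret  : Method → St → ALab

  AAct : Set
  AAct = ℕ × ALab

  data Step (Γ : MSpec) : St → Act → St → AAct → Set₁ where
    s-cmd  : ∀ {t c σ σ' P} → f t c σ ≡ ok P → P σ' →
             Step Γ σ (t , lc c) σ' (t , acmd c)
    s-call : ∀ {t m s σ σp σ'} → Γ m ≡ just s → p s t σp → σp * σ' ≡ just σ →
             Step Γ σ (t , lcall m) σ' (t , acall m σp)
    s-ret  : ∀ {t m s σ σq σ'} → Γ m ≡ just s → q s t σq → σ * σq ≡ just σ' →
             Step Γ σ (t , lret m) σ' (t , aret m σq)

  data Fault (Γ : MSpec) : St → Act → Set₁ where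
    f-cmd  : ∀ {t c σ} → f t c σ ≡ fault → Fault Γ σ (t , lc c)
    f-call : ∀ {t m s σ} → Γ m ≡ just s →
             ¬ (∃ λ σp → ∃ λ σr → p s t σp × (σp * σr ≡ just σ)) →
             Fault Γ σ (t , lcall m)

  data Reach (Γ : MSpec) : St → List Act → St → List AAct → Set₁ where
    r-nil  : ∀ {σ} → Reach Γ σ [] σ []
    r-cons : ∀ {σ σ₁ σ' a α τ κ} → Step Γ σ a σ₁ α → Reach Γ σ₁ τ σ' κ →
             Reach Γ σ (a ∷ τ) σ' (α ∷ κ)

  data Faults (Γ : MSpec) : St → List Act → Set₁ where
    fs-here  : ∀ {σ a τ} → Fault Γ σ a → Faults Γ σ (a ∷ τ)
    fs-later : ∀ {σ σ₁ a α τ} → Step Γ σ a σ₁ α → Faults Γ σ₁ τ → Faults Γ σ (a ∷ τ)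

  Safe : MSpec → Client → St → Set₁
  Safe Γ cl σ = ∀ τ → Traces cl τ → ¬ Faults Γ σ τ

  InSem : MSpec → Client → St → List AAct → Set₁
  InSem Γ cl σ κ = ∃ λ τ → ∃ λ σ' → Traces cl τ × Reach Γ σ τ σ' κ

  data IAct : Set where
    icall : Method → St → IAct
    iret  : Method → St → IAct

  HAct : Set
  HAct = ℕ × IAct

  History : Set
  History = List HAct

  history : List AAct → History
  history [] = []
  history ((t , acmd c) ∷ κ) = history κ
  history ((t , acall m σ) ∷ κ) = (t , icall m σ) ∷ history κ
  history ((t , aret m σ) ∷ κ) = (t , iret m σ) ∷ history κ

  nonInterface : List AAct → List (ℕ × Cmd)
  nonInterface [] = []
  nonInterface ((t , acmd c) ∷ κ) = (t , c) ∷ nonInterface κ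
  nonInterface ((t , acall m σ) ∷ κ) = nonInterface κ
  nonInterface ((t , aret m σ) ∷ κ) = nonInterface κ

  projA : ℕ → List AAct → List AAct
  projA t [] = []
  projA t ((t' , x) ∷ κ) with t ≟ t'
  ... | yes _ = (t' , x) ∷ projA t κ
  ... | no  _ = projA t κ

  projH : ℕ → History → List IAct
  projH t [] = []
  projH t ((t' , x) ∷ H) with t ≟ t'
  ... | yes _ = x ∷ projH t H
  ... | no  _ = projH t H

  data Alt : Maybe Method → List IAct → Set where
    alt-nil  : ∀ {st} → Alt st []
    alt-call : ∀ {m σ w} → Alt (just m) w → Alt nothing (icall m σ ∷ w)
    alt-ret  : ∀ {m σ w} → Alt nothing w → Alt (just m) (iret m σ ∷ w)

  WFHistory : History → Set
  WFHistory H = ∀ t → Alt nothing (projH t H)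

  BalStep : St → IAct → St → Set
  BalStep l (icall m σ) l' = Comp l σ l'
  BalStep l (iret m σ) l' = Sub l σ l'

  BalFrom : St → History → St → Set
  BalFrom l [] r = r ≈δ l
  BalFrom l ((t , ψ) ∷ H) r = ∃ λ l₁ → BalStep l ψ l₁ × BalFrom l₁ H r

  Balanced : St → History → Set
  Balanced l H = ∃ λ r → BalFrom l H r

  IsCall IsRet : HAct → Set
  IsCall (t , icall m σ) = ⊤
  IsCall (t , iret m σ) = ⊥
  IsRet (t , icall m σ) = ⊥
  IsRet (t , iret m σ) = ⊤

  record _⊑H_ (H H' : History) : Set where
    field
      ρ     : Fin (length H) ⤖ Fin (length H')
      pres  : ∀ i → lookup H i ≡ lookup H' (Bijection.to ρ i)
      order : ∀ i j → i <ᶠ j →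
              (proj₁ (lookup H i) ≡ proj₁ (lookup H j)
                ⊎ (IsRet (lookup H i) × IsCall (lookup H j))) →
              Bijection.to ρ i <ᶠ Bijection.to ρ j

  _⊑_ : St × History → St × History → Set
  (l , H) ⊑ (l' , H') = (l' ⪯ l) × (H ⊑H H')

  _∼_ : List AAct → List AAct → Set
  κ ∼ κ' = (∀ t → projA t κ ≡ projA t κ') × (nonInterface κ ≡ nonInterface κ')

-- κ' is obtained by replaying κ in the order prescribed by H', keeping the original run as a
-- reference: the replay state is always the original state framed by the preconditions of calls
-- that κ has made but the replay has postponed, and by the postconditions of returns that the
-- replay has performed ahead of κ. Commands are replayed at their original position, which is
-- sound by strong locality and footprint preservation; postponing a call only removes σp later;
-- an early return is possible because H' is balanced from δ(σ)∘l', so its postcondition can be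
-- added to the current state. H ⊑ H' keeps the order of each thread's interface actions, and in
-- every thread a call is immediately followed by its return, so the projections on threads and
-- the sequence of commands are unchanged.
module Submission where

open import Defs
open import Data.Product using (∃; _×_; _,_)
open import Data.Maybe using (Maybe; just)
open import Relation.Binary.PropositionalEquality using (_≡_)

open import Algebra.Bundles using (CommutativeMonoid)
open import Data.Empty using (⊥; ⊥-elim)
open import Data.Fin using (Fin; zero; suc; punchIn; punchOut) renaming (_<_ to _<ᶠ_)
open import Data.Fin.Properties
  using (punchIn-injective; punchIn-mono-≤; punchInᵢ≢i; punchOut-injective; punchOut-mono-≤;
         punchIn-punchOut; suc-injective; <⇒≢; ≤∧≢⇒<)
open import Data.List using (List; []; _∷_; _++_; length; map; tabulate)
open import Data.List.Properties using (tabulate-lookup; ++-assoc; ++-identityʳ; ++-conicalˡ; ++-conicalʳ; length-++-sucʳ; ∷-injectiveˡ; ∷-injectiveʳ; map-∘; map-++)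
open import Data.List.Relation.Unary.All using (All; []; _∷_)
open import Data.List.Relation.Unary.All.Properties using (map⁺; ++⁻ʳ)
open import Data.Maybe using (nothing; _>>=_)
open import Data.Nat using (ℕ; zero; suc; _+_; _<_; z≤n; s≤s; z<s; _≟_)
open import Data.Nat.Properties using (<⇒≤; ≤-reflexive; <-≤-trans; n<1+n; m<n+m; +-suc; +-monoʳ-<)
open import Data.Product using (Σ; proj₁; proj₂)
open import Data.Sum using (_⊎_; inj₁; inj₂)
open import Data.Unit using (⊤; tt)
open import Function using (_∘_)
open import Function.Bundles using (Equivalence; Bijection)
open import Relation.Nullary using (¬_; yes; no)
open import Relation.Binary.PropositionalEquality
  using (_≢_; refl; sym; trans; cong; cong₂; subst; subst₂; isEquivalence; module ≡-Reasoning)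

∷≢[] : ∀ {X : Set} {x : X} {xs} → _≢_ {A = List X} (x ∷ xs) []
∷≢[] ()

++-∷-≢-[] : ∀ {X : Set} (A : List X) h B → A ++ h ∷ B ≢ []
++-∷-≢-[] A h B = ∷≢[] ∘ ++-conicalʳ A (h ∷ B)

map-≡-[] : ∀ {ℓ} {X : Set ℓ} {Y : Set} (g : X → Y) xs → map g xs ≡ [] → xs ≡ []
map-≡-[] g [] _ = refl

split-++-∷ : ∀ {X : Set} (xs ys A B : List X) h → xs ++ ys ≡ A ++ h ∷ B →
  (∃ λ B₁ → xs ≡ A ++ h ∷ B₁ × B ≡ B₁ ++ ys) ⊎ (∃ λ A₂ → A ≡ xs ++ A₂ × ys ≡ A₂ ++ h ∷ B)
split-++-∷ []       ys A       B h eq = inj₂ (A , refl , eq)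
split-++-∷ (x ∷ xs) ys []      B h eq = inj₁ (xs , cong (_∷ xs) (∷-injectiveˡ eq) , sym (∷-injectiveʳ eq))
split-++-∷ (x ∷ xs) ys (a ∷ A) B h eq with split-++-∷ xs ys A B h (∷-injectiveʳ eq)
... | inj₁ (B₁ , xs≡ , B≡) = inj₁ (B₁ , cong₂ _∷_ (∷-injectiveˡ eq) xs≡ , B≡)
... | inj₂ (A₂ , A≡ , ys≡) = inj₂ (A₂ , cong₂ _∷_ (sym (∷-injectiveˡ eq)) A≡ , ys≡)

map-≡-++-∷ : ∀ {ℓ} {Y : Set ℓ} {X : Set} (g : Y → X) ys A h B → map g ys ≡ A ++ h ∷ B →
  ∃ λ Ya → ∃ λ y → ∃ λ Yb → ys ≡ Ya ++ y ∷ Yb × map g Ya ≡ A × g y ≡ h × map g Yb ≡ B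
map-≡-++-∷ g []       A       h B eq = ⊥-elim (++-∷-≢-[] A h B (sym eq))
map-≡-++-∷ g (y ∷ ys) []      h B eq = [] , y , ys , refl , refl , ∷-injectiveˡ eq , ∷-injectiveʳ eq
map-≡-++-∷ g (y ∷ ys) (a ∷ A) h B eq with map-≡-++-∷ g ys A h B (∷-injectiveʳ eq)
... | Ya , y' , Yb , ys≡ , Ya≡ , y'≡ , Yb≡ = y ∷ Ya , y' , Yb , cong (y ∷_) ys≡ , cong₂ _∷_ (∷-injectiveˡ eq) Ya≡ , y'≡ , Yb≡

punchIn-mono-< : ∀ {n} (i : Fin (suc n)) {j k : Fin n} → j <ᶠ k → punchIn i j <ᶠ punchIn i k
punchIn-mono-< i {j} {k} j<k =
  ≤∧≢⇒< (punchIn-mono-≤ i j k (<⇒≤ j<k)) (<⇒≢ j<k ∘ punchIn-injective i j k)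

punchOut-mono-< : ∀ {n} {i j k : Fin (suc n)} (i≢j : i ≢ j) (i≢k : i ≢ k) →
  j <ᶠ k → punchOut i≢j <ᶠ punchOut i≢k
punchOut-mono-< i≢j i≢k j<k =
  ≤∧≢⇒< (punchOut-mono-≤ i≢j i≢k (<⇒≤ j<k)) (<⇒≢ j<k ∘ punchOut-injective i≢j i≢k)

module Reordering {X : Set} (_R_ : X → X → Set) where

  -- An inductive reading of ⊑ on histories: the first element of the reordered list may
  -- overtake exactly those earlier elements it is not R-related to.
  data _≼_ : List X → List X → Set where
    []   : [] ≼ []
    pull : ∀ {A B h H} → All (λ a → ¬ a R h) A → (A ++ B) ≼ H → (A ++ h ∷ B) ≼ (h ∷ H)

  record Reindexing {m n} (f : Fin m → X) (g : Fin n → X) : Set where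
    field
      to         : Fin m → Fin n
      injective  : ∀ i j → to i ≡ to j → i ≡ j
      surjective : ∀ k → ∃ λ i → to i ≡ k
      pres       : ∀ i → f i ≡ g (to i)
      order      : ∀ i j → i <ᶠ j → f i R f j → to i <ᶠ to j

  tabulate-extract : ∀ {n} (f : Fin (suc n) → X) (i : Fin (suc n)) (P : X → Set) →
    (∀ k → k <ᶠ i → P (f k)) →
    ∃ λ A → ∃ λ B → tabulate f ≡ A ++ f i ∷ B × A ++ B ≡ tabulate (f ∘ punchIn i) × All P A
  tabulate-extract f zero P _ = [] , tabulate (f ∘ suc) , refl , refl , []
  tabulate-extract {suc n} f (suc i) P before
    with tabulate-extract (f ∘ suc) i P (λ k k<i → before (suc k) (s≤s k<i))
  ... | A , B , f≡ , f∘punchIn≡ , PA =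
    f zero ∷ A , B , cong (f zero ∷_) f≡ , cong (f zero ∷_) f∘punchIn≡ , before zero (s≤s z≤n) ∷ PA

  -- The element sent to position zero is pulled to the front; removing it leaves a reindexing
  -- of the remaining elements.
  reindexing⇒≼ : ∀ {m n} {f : Fin m → X} {g : Fin n → X} → Reindexing f g → tabulate f ≼ tabulate g
  reindexing⇒≼ {zero} {zero} _ = []
  reindexing⇒≼ {zero} {suc n} ρ with Reindexing.surjective ρ zero
  ... | () , _
  reindexing⇒≼ {suc m} {zero} ρ with Reindexing.to ρ zero
  ... | ()
  reindexing⇒≼ {suc m} {suc n} {f} {g} ρ = pull-front
    where
    open Reindexing ρ
    i = proj₁ (surjective zero)
    toi≡0 : to i ≡ zero
    toi≡0 = proj₂ (surjective zero)
    earlier-unrelated : ∀ k → k <ᶠ i → ¬ f k R f i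
    earlier-unrelated k k<i kRi with order k i k<i kRi
    ... | tok<toi rewrite toi≡0 with tok<toi
    ... | ()
    0≢to : ∀ k → zero ≢ to (punchIn i k)
    0≢to k 0≡to = punchInᵢ≢i i k (injective _ _ (trans (sym 0≡to) (sym toi≡0)))
    ρ' : Reindexing (f ∘ punchIn i) (g ∘ suc)
    ρ' = record
      { to         = λ k → punchOut (0≢to k)
      ; injective  = λ a b eq → punchIn-injective i a b (injective _ _ (punchOut-injective (0≢to a) (0≢to b) eq))
      ; surjective = λ k → surjective' k (surjective (suc k))
      ; pres       = λ k → trans (pres (punchIn i k)) (cong g (sym (punchIn-punchOut (0≢to k))))
      ; order      = λ a b a<b aRb → punchOut-mono-< (0≢to a) (0≢to b) (order _ _ (punchIn-mono-< i a<b) aRb)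
      }
      where
      surjective' : ∀ k → (∃ λ x → to x ≡ suc k) → ∃ λ j → punchOut (0≢to j) ≡ k
      surjective' k (x , tox≡) = punchOut i≢x ,
        suc-injective (trans (punchIn-punchOut (0≢to (punchOut i≢x))) (trans (cong to (punchIn-punchOut i≢x)) tox≡))
        where
        i≢x : i ≢ x
        i≢x i≡x with trans (sym tox≡) (trans (cong to (sym i≡x)) toi≡0)
        ... | ()
    pull-front : tabulate f ≼ tabulate g
    pull-front with tabulate-extract f i (λ a → ¬ a R f i) earlier-unrelated
    ... | A , B , f≡ , rest≡ , unrelated =
      subst₂ _≼_ (sym f≡) (cong (_∷ tabulate (g ∘ suc)) (trans (pres i) (cong g toi≡0)))
        (pull unrelated (subst (_≼ tabulate (g ∘ suc)) (sym rest≡) (reindexing⇒≼ ρ')))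

data Kind : Set where
  cmd call ret : Kind

-- y ⇢ z : within one thread, an action of kind z may directly follow one of kind y.
_⇢_ : Kind → Kind → Set
cmd  ⇢ cmd  = ⊤
cmd  ⇢ call = ⊤
call ⇢ ret  = ⊤
ret  ⇢ cmd  = ⊤
ret  ⇢ call = ⊤
_    ⇢ _    = ⊥

Chain : List Kind → Set
Chain []           = ⊤
Chain (_ ∷ [])     = ⊤
Chain (y ∷ z ∷ ks) = y ⇢ z × Chain (z ∷ ks)

-- Framing by commands rules out a leading return and a trailing unanswered call.
Closed : List Kind → Set
Closed w = Chain (cmd ∷ w ++ cmd ∷ [])

Chain-tail : ∀ k ks → Chain (k ∷ ks) → Chain ks
Chain-tail k []       _         = tt
Chain-tail k (_ ∷ ks) (_ , ch)  = ch

Chain-prefix : ∀ xs ys → Chain (xs ++ ys) → Chain xs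
Chain-prefix []           ys _        = tt
Chain-prefix (_ ∷ [])     ys _        = tt
Chain-prefix (x ∷ y ∷ xs) ys (p , ch) = p , Chain-prefix (y ∷ xs) ys ch

Chain-join : ∀ xs ys → Chain (xs ++ cmd ∷ []) → Chain (cmd ∷ ys) → Chain (xs ++ ys)
Chain-join []           ys          _        ch       = Chain-tail cmd ys ch
Chain-join (_ ∷ [])     []          _        _        = tt
Chain-join (cmd ∷ [])   (_ ∷ ys)    _        (p , ch) = p , ch
Chain-join (ret ∷ [])   (cmd ∷ ys)  _        (_ , ch) = tt , ch
Chain-join (ret ∷ [])   (call ∷ ys) _        (_ , ch) = tt , ch
Chain-join (x ∷ y ∷ xs) ys          (p , ch) ch'      = p , Chain-join (y ∷ xs) ys ch ch'

Closed-++ : ∀ w₁ w₂ → Closed w₁ → Closed w₂ → Closed (w₁ ++ w₂)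
Closed-++ w₁ w₂ c₁ c₂ = subst Chain (cong (cmd ∷_) (sym (++-assoc w₁ w₂ (cmd ∷ []))))
  (Chain-join (cmd ∷ w₁) (w₂ ++ cmd ∷ []) c₁ c₂)

Closed-prefix : ∀ xs ys → Closed (xs ++ ys) → Chain xs
Closed-prefix xs ys closed = Chain-tail cmd xs (Chain-prefix (cmd ∷ xs) (ys ++ cmd ∷ [])
  (subst Chain (cong (cmd ∷_) (++-assoc xs ys (cmd ∷ []))) closed))

Chain-calls-before : ∀ ks k ms → Chain (ks ++ k ∷ ms) → All (_≡ call) ks → k ≢ ret → ks ≡ []
Chain-calls-before []                  k   ms _ _                  _    = refl
Chain-calls-before (.call ∷ [])        ret ms _ (refl ∷ _)         k≢ret = ⊥-elim (k≢ret refl)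
Chain-calls-before (.call ∷ .call ∷ _) k   ms (() , _) (refl ∷ refl ∷ _) _

Chain-cmds-before-ret : ∀ ks ms → Chain (ks ++ ret ∷ ms) → All (_≡ cmd) ks → ks ≡ []
Chain-cmds-before-ret []                ms _        _                 = refl
Chain-cmds-before-ret (.cmd ∷ .cmd ∷ ks) ms (_ , ch) (refl ∷ refl ∷ c) with Chain-cmds-before-ret (cmd ∷ ks) ms ch (refl ∷ c)
... | ()

module Lifted (SA : SepAlg) where
  open SepAlg SA
  open FpDefs SA

  infixl 7 _⊗_
  _⊗_ : Maybe St → Maybe St → Maybe St
  just a  ⊗ y = y >>= a *_
  nothing ⊗ y = nothing

  ⊗-comm : ∀ x y → x ⊗ y ≡ y ⊗ x
  ⊗-comm (just a) (just b) = *-comm a b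
  ⊗-comm (just a) nothing  = refl
  ⊗-comm nothing  (just b) = refl
  ⊗-comm nothing  nothing  = refl

  ⊗-assoc : ∀ x y z → (x ⊗ y) ⊗ z ≡ x ⊗ (y ⊗ z)
  ⊗-assoc (just a) (just b) (just c) = trans (sym (>>=-* (a * b))) (*-assoc a b c)
    where
    >>=-* : ∀ x {c} → (x >>= _* c) ≡ x ⊗ just c
    >>=-* (just _) = refl
    >>=-* nothing  = refl
  ⊗-assoc (just a) (just b) nothing with a * b
  ... | just _  = refl
  ... | nothing = refl
  ⊗-assoc (just a) nothing  z = refl
  ⊗-assoc nothing  y        z = refl

  ⊗-identityˡ : ∀ x → just e ⊗ x ≡ x
  ⊗-identityˡ (just a) = *-unit a
  ⊗-identityˡ nothing  = refl

  ⊗-identityʳ : ∀ x → x ⊗ just e ≡ x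
  ⊗-identityʳ x = trans (⊗-comm x (just e)) (⊗-identityˡ x)

  ⊗-commutativeMonoid : CommutativeMonoid _ _
  ⊗-commutativeMonoid = record
    { Carrier = Maybe St ; _≈_ = _≡_ ; _∙_ = _⊗_ ; ε = just e
    ; isCommutativeMonoid = record
      { isMonoid = record
        { isSemigroup = record
          { isMagma = record { isEquivalence = isEquivalence ; ∙-cong = cong₂ _⊗_ }
          ; assoc = ⊗-assoc }
        ; identity = ⊗-identityˡ , ⊗-identityʳ }
      ; comm = ⊗-comm } }

  ∏ : List St → Maybe St
  ∏ []       = just e
  ∏ (a ∷ as) = just a ⊗ ∏ as

  open import Algebra.Properties.CommutativeSemigroup
    (CommutativeMonoid.commutativeSemigroup ⊗-commutativeMonoid) using (x∙yz≈y∙xz)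

  ∏-++-∷ : ∀ as b bs → ∏ (as ++ b ∷ bs) ≡ just b ⊗ ∏ (as ++ bs)
  ∏-++-∷ []       b bs = refl
  ∏-++-∷ (a ∷ as) b bs = trans (cong (just a ⊗_) (∏-++-∷ as b bs)) (x∙yz≈y∙xz (just a) (just b) (∏ (as ++ bs)))

  ⊗-definedˡ : ∀ x y {z} → x ⊗ y ≡ just z → ∃ λ a → x ≡ just a
  ⊗-definedˡ (just a) y _  = a , refl
  ⊗-definedˡ nothing  y ()

  ⊗-definedʳ : ∀ x y {z} → x ⊗ y ≡ just z → ∃ λ b → y ≡ just b
  ⊗-definedʳ x y eq = ⊗-definedˡ y x (trans (⊗-comm y x) eq)

  ⪯-frame : ∀ {σ l l'} → Defined (σ * l) → l' ⪯ l → Defined (σ * l')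
  ⪯-frame {σ} {l} {l'} (y , σl) (_ , σ₁ , σ₂ , σ₃ , σ₁≈l' , σ₂≈l , σ₁σ₃ , _) =
    subst Defined (*-comm l' σ) (Equivalence.to (σ₁≈l' σ) σ₁σ)
    where
    σ₂σ : Defined (σ₂ * σ)
    σ₂σ = Equivalence.from (σ₂≈l σ) (y , trans (*-comm l σ) σl)
    σ₂σ≡σ₁σσ₃ : just σ₂ ⊗ just σ ≡ (just σ₁ ⊗ just σ) ⊗ just σ₃
    σ₂σ≡σ₁σσ₃ = begin
      just σ₂ ⊗ just σ                 ≡⟨ cong (_⊗ just σ) (sym σ₁σ₃) ⟩
      (just σ₁ ⊗ just σ₃) ⊗ just σ     ≡⟨ ⊗-assoc (just σ₁) (just σ₃) (just σ) ⟩
      just σ₁ ⊗ (just σ₃ ⊗ just σ)     ≡⟨ cong (just σ₁ ⊗_) (⊗-comm (just σ₃) (just σ)) ⟩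
      just σ₁ ⊗ (just σ ⊗ just σ₃)     ≡⟨ sym (⊗-assoc (just σ₁) (just σ) (just σ₃)) ⟩
      (just σ₁ ⊗ just σ) ⊗ just σ₃     ∎
      where open ≡-Reasoning
    σ₁σ : Defined (σ₁ * σ)
    σ₁σ = ⊗-definedˡ (just σ₁ ⊗ just σ) (just σ₃) (trans (sym σ₂σ≡σ₁σσ₃) (proj₂ σ₂σ))

  -- At a call σp moves from the client state into the library footprint.
  Comp-frame : ∀ {u l l₁ σp u₀} → Defined (u * l) → Comp l σp l₁ → σp * u₀ ≡ just u → Defined (u₀ * l₁)
  Comp-frame {u} {l} {l₁} {σp} {u₀} (y , ul) (d , lσp , d≈l₁) σpu₀ =
    subst Defined (*-comm l₁ u₀) (Equivalence.to (d≈l₁ u₀) (y , du₀))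
    where
    du₀ : d * u₀ ≡ just y
    du₀ = begin
      just d ⊗ just u₀                ≡⟨ cong (_⊗ just u₀) (sym lσp) ⟩
      (just l ⊗ just σp) ⊗ just u₀    ≡⟨ ⊗-assoc (just l) (just σp) (just u₀) ⟩
      just l ⊗ (just σp ⊗ just u₀)    ≡⟨ cong (just l ⊗_) σpu₀ ⟩
      just l ⊗ just u                 ≡⟨ ⊗-comm (just l) (just u) ⟩
      just u ⊗ just l                 ≡⟨ ul ⟩
      just y                          ∎
      where open ≡-Reasoning

  -- At a return the balance of the history guarantees that σq can be added to the client state.
  Sub-frame : ∀ {u l l₁ σq} → Defined (u * l) → Sub l σq l₁ →
    ∃ λ u₁ → u * σq ≡ just u₁ × Defined (u₁ * l₁)
  Sub-frame {u} {l} {l₁} {σq} (y , ul) (σ₁ , σ₂ , σ₃ , σ₁≈σq , σ₂≈l , σ₁σ₃ , σ₃≈l₁) =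
    u₁ , uσq , subst Defined (*-comm l₁ u₁) (Equivalence.to (σ₃≈l₁ u₁) (proj₁ σq₃u , σ₃u₁))
    where
    σ₂u : Defined (σ₂ * u)
    σ₂u = Equivalence.from (σ₂≈l u) (y , trans (*-comm l u) ul)
    σ₂u≡σ₁σ₃u : just σ₂ ⊗ just u ≡ just σ₁ ⊗ (just σ₃ ⊗ just u)
    σ₂u≡σ₁σ₃u = trans (cong (_⊗ just u) (sym σ₁σ₃)) (⊗-assoc (just σ₁) (just σ₃) (just u))
    w = ⊗-definedʳ (just σ₁) (just σ₃ ⊗ just u) (trans (sym σ₂u≡σ₁σ₃u) (proj₂ σ₂u))
    σq₃u : Defined (σq * proj₁ w)
    σq₃u = Equivalence.to (σ₁≈σq (proj₁ w))
      (proj₁ σ₂u , trans (cong (just σ₁ ⊗_) (sym (proj₂ w))) (trans (sym σ₂u≡σ₁σ₃u) (proj₂ σ₂u)))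
    σ₃uσq : just σ₃ ⊗ (just u ⊗ just σq) ≡ just (proj₁ σq₃u)
    σ₃uσq = begin
      just σ₃ ⊗ (just u ⊗ just σq)   ≡⟨ sym (⊗-assoc (just σ₃) (just u) (just σq)) ⟩
      (just σ₃ ⊗ just u) ⊗ just σq   ≡⟨ ⊗-comm (just σ₃ ⊗ just u) (just σq) ⟩
      just σq ⊗ (just σ₃ ⊗ just u)   ≡⟨ cong (just σq ⊗_) (proj₂ w) ⟩
      just σq ⊗ just (proj₁ w)       ≡⟨ proj₂ σq₃u ⟩
      just (proj₁ σq₃u)              ∎
      where open ≡-Reasoning
    u₁ = proj₁ (⊗-definedʳ (just σ₃) (just u ⊗ just σq) σ₃uσq)
    uσq : u * σq ≡ just u₁
    uσq = proj₂ (⊗-definedʳ (just σ₃) (just u ⊗ just σq) σ₃uσq)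
    σ₃u₁ : σ₃ * u₁ ≡ just (proj₁ σq₃u)
    σ₃u₁ = trans (cong (just σ₃ ⊗_) (sym uσq)) σ₃uσq

module Histories (S : Setting) where
  open Setting S
  open SepAlg SA
  open FpDefs SA
  open Sem S hiding (_⊕_)

  kindₗ : Lab → Kind
  kindₗ (lc _)    = cmd
  kindₗ (lcall _) = call
  kindₗ (lret _)  = ret

  unannotate : ALab → Lab
  unannotate (acmd c)    = lc c
  unannotate (acall m _) = lcall m
  unannotate (aret m _)  = lret m

  erase : AAct → Act
  erase (t , a) = t , unannotate a

  kind : AAct → Kind
  kind (_ , a) = kindₗ (unannotate a)

  WellLinked : List AAct → Set
  WellLinked κ = ∀ t → Chain (map kind (projA t κ))

  MustPrecede : HAct → HAct → Set
  MustPrecede x y = proj₁ x ≡ proj₁ y ⊎ (IsRet x × IsCall y)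

  open Reordering MustPrecede public

  projA-++ : ∀ t xs ys → projA t (xs ++ ys) ≡ projA t xs ++ projA t ys
  projA-++ t [] ys = refl
  projA-++ t ((t' , a) ∷ xs) ys with t ≟ t'
  ... | yes _ = cong ((t' , a) ∷_) (projA-++ t xs ys)
  ... | no  _ = projA-++ t xs ys

  projL-++ : ∀ t xs ys → projL t (xs ++ ys) ≡ projL t xs ++ projL t ys
  projL-++ t [] ys = refl
  projL-++ t ((t' , a) ∷ xs) ys with t ≟ t'
  ... | yes _ = cong (a ∷_) (projL-++ t xs ys)
  ... | no  _ = projL-++ t xs ys

  history-++ : ∀ xs ys → history (xs ++ ys) ≡ history xs ++ history ys
  history-++ []                    ys = refl
  history-++ ((t , acmd c)    ∷ xs) ys = history-++ xs ys
  history-++ ((t , acall m σ) ∷ xs) ys = cong (_ ∷_) (history-++ xs ys)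
  history-++ ((t , aret m σ)  ∷ xs) ys = cong (_ ∷_) (history-++ xs ys)

  nonInterface-++ : ∀ xs ys → nonInterface (xs ++ ys) ≡ nonInterface xs ++ nonInterface ys
  nonInterface-++ []                    ys = refl
  nonInterface-++ ((t , acmd c)    ∷ xs) ys = cong (_ ∷_) (nonInterface-++ xs ys)
  nonInterface-++ ((t , acall m σ) ∷ xs) ys = nonInterface-++ xs ys
  nonInterface-++ ((t , aret m σ)  ∷ xs) ys = nonInterface-++ xs ys

  projA-here : ∀ t a κ → projA t ((t , a) ∷ κ) ≡ (t , a) ∷ projA t κ
  projA-here t a κ with t ≟ t
  ... | yes _  = refl
  ... | no t≢t = ⊥-elim (t≢t refl)

  projA-∷-cong : ∀ t x {κ κ'} → projA t κ ≡ projA t κ' → projA t (x ∷ κ) ≡ projA t (x ∷ κ')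
  projA-∷-cong t (t' , a) eq with t ≟ t'
  ... | yes _ = cong (_ ∷_) eq
  ... | no  _ = eq

  projA-middle : ∀ P x Q → projA (proj₁ x) (P ++ x ∷ Q) ≡ projA (proj₁ x) P ++ x ∷ projA (proj₁ x) Q
  projA-middle P (t , a) Q = trans (projA-++ t P ((t , a) ∷ Q)) (cong (projA t P ++_) (projA-here t a Q))

  projA-move-front : ∀ P x Q → projA (proj₁ x) P ≡ [] →
    ∀ t → projA t (x ∷ P ++ Q) ≡ projA t (P ++ x ∷ Q)
  projA-move-front P (t' , a) Q P↾t'≡[] t with t ≟ t'
  ... | yes refl = begin
    (t , a) ∷ projA t (P ++ Q)        ≡⟨ cong ((t , a) ∷_) (projA-++ t P Q) ⟩
    (t , a) ∷ projA t P ++ projA t Q  ≡⟨ cong (λ p → (t , a) ∷ p ++ projA t Q) P↾t'≡[] ⟩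
    (t , a) ∷ projA t Q               ≡⟨ cong (_++ (t , a) ∷ projA t Q) (sym P↾t'≡[]) ⟩
    projA t P ++ (t , a) ∷ projA t Q  ≡⟨ sym (projA-middle P (t , a) Q) ⟩
    projA t (P ++ (t , a) ∷ Q)        ∎
    where open ≡-Reasoning
  ... | no t≢t' = begin
    projA t (P ++ Q)                  ≡⟨ projA-++ t P Q ⟩
    projA t P ++ projA t Q            ≡⟨ cong (projA t P ++_) (projA-there (t' , a) Q t≢t') ⟩
    projA t P ++ projA t ((t' , a) ∷ Q) ≡⟨ sym (projA-++ t P ((t' , a) ∷ Q)) ⟩
    projA t (P ++ (t' , a) ∷ Q)       ∎
    where
    open ≡-Reasoning
    projA-there : ∀ x Q → t ≢ proj₁ x → projA t Q ≡ projA t (x ∷ Q)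
    projA-there (t' , _) Q t≢t' with t ≟ t'
    ... | yes t≡t' = ⊥-elim (t≢t' t≡t')
    ... | no  _    = refl

  nonInterface-move-front : ∀ P x Q → nonInterface (x ∷ []) ≡ [] ⊎ nonInterface P ≡ [] →
    nonInterface (x ∷ P ++ Q) ≡ nonInterface (P ++ x ∷ Q)
  nonInterface-move-front P x Q x-or-P-silent = begin
    nonInterface (x ∷ P ++ Q)                ≡⟨ nonInterface-++ (x ∷ []) (P ++ Q) ⟩
    X ++ nonInterface (P ++ Q)               ≡⟨ cong (X ++_) (nonInterface-++ P Q) ⟩
    X ++ N ++ nonInterface Q                 ≡⟨ sym (++-assoc X N _) ⟩
    (X ++ N) ++ nonInterface Q               ≡⟨ cong (_++ nonInterface Q) (silent-comm x-or-P-silent) ⟩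
    (N ++ X) ++ nonInterface Q               ≡⟨ ++-assoc N X _ ⟩
    N ++ X ++ nonInterface Q                 ≡⟨ cong (N ++_) (sym (nonInterface-++ (x ∷ []) Q)) ⟩
    N ++ nonInterface (x ∷ Q)                ≡⟨ sym (nonInterface-++ P (x ∷ Q)) ⟩
    nonInterface (P ++ x ∷ Q)                ∎
    where
    open ≡-Reasoning
    X = nonInterface (x ∷ [])
    N = nonInterface P
    silent-comm : X ≡ [] ⊎ N ≡ [] → X ++ N ≡ N ++ X
    silent-comm (inj₁ X≡[]) rewrite X≡[] = sym (++-identityʳ N)
    silent-comm (inj₂ N≡[]) rewrite N≡[] = ++-identityʳ X

  projL-erase : ∀ t κ → projL t (map erase κ) ≡ map (unannotate ∘ proj₂) (projA t κ)
  projL-erase t [] = refl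
  projL-erase t ((t' , a) ∷ κ) with t ≟ t'
  ... | yes _ = cong (unannotate a ∷_) (projL-erase t κ)
  ... | no  _ = projL-erase t κ

  kinds-projL-erase : ∀ t κ → map kindₗ (projL t (map erase κ)) ≡ map kind (projA t κ)
  kinds-projL-erase t κ = trans (cong (map kindₗ) (projL-erase t κ)) (sym (map-∘ (projA t κ)))

  Gen⇒Closed : ∀ {C w} → Gen C w → Closed (map kindₗ w)
  Gen⇒Closed g-prim = tt , tt , tt
  Gen⇒Closed g-call = tt , tt , tt , tt
  Gen⇒Closed (g-seq {w₁ = w₁} {w₂ = w₂} g₁ g₂) =
    subst Closed (sym (map-++ kindₗ w₁ w₂)) (Closed-++ _ _ (Gen⇒Closed g₁) (Gen⇒Closed g₂))
  Gen⇒Closed (g-chˡ g) = Gen⇒Closed g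
  Gen⇒Closed (g-chʳ g) = Gen⇒Closed g
  Gen⇒Closed g-nil = tt , tt
  Gen⇒Closed (g-cons {w₁ = w₁} {w₂ = w₂} g₁ g₂) =
    subst Closed (sym (map-++ kindₗ w₁ w₂)) (Closed-++ _ _ (Gen⇒Closed g₁) (Gen⇒Closed g₂))

  All-threads⇒ : ∀ {P : ℕ → Set} τ → All (P ∘ proj₁) τ → ∀ t → projL t τ ≢ [] → P t
  All-threads⇒ []             _          t τ↾t≢[] = ⊥-elim (τ↾t≢[] refl)
  All-threads⇒ ((t' , a) ∷ τ) (Pt' ∷ Pτ) t τ↾t≢[] with t ≟ t'
  ... | yes refl = Pt'
  ... | no  _    = All-threads⇒ τ Pτ t τ↾t≢[]

  ⇒All-threads : ∀ {P : ℕ → Set} τ → (∀ t → projL t τ ≢ [] → P t) → All (P ∘ proj₁) τ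
  ⇒All-threads []             _  = []
  ⇒All-threads ((t , a) ∷ τ) Pτ = head ∷ ⇒All-threads τ tail
    where
    head = Pτ t (λ τ↾t≡[] → case-here τ↾t≡[])
      where
      case-here : projL t ((t , a) ∷ τ) ≢ []
      case-here with t ≟ t
      ... | yes _  = λ ()
      ... | no t≢t = ⊥-elim (t≢t refl)
    tail : ∀ t' → projL t' τ ≢ [] → _
    tail t' τ↾t'≢[] with t' ≟ t | Pτ t'
    ... | yes _ | Pt' = Pt' (λ ())
    ... | no  _ | Pt' = Pt' τ↾t'≢[]

  Traces-resp-projL : ∀ cl {τ₁ τ₂} → (∀ t → projL t τ₁ ≡ projL t τ₂) → Traces cl τ₂ → Traces cl τ₁
  Traces-resp-projL cl {τ₁} {τ₂} τ₁≗τ₂ (τ' , threads , gens) =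
    τ' , ⇒All-threads (τ₁ ++ τ') (λ t ne → All-threads⇒ (τ₂ ++ τ') threads t (ne ∘ trans (same t))) ,
    λ i → subst (Gen (Client.body cl i)) (sym (same _)) (gens i)
    where
    same : ∀ t → projL t (τ₁ ++ τ') ≡ projL t (τ₂ ++ τ')
    same t = trans (projL-++ t τ₁ τ') (trans (cong (_++ projL t τ') (τ₁≗τ₂ t)) (sym (projL-++ t τ₂ τ')))

  Traces⇒WellLinked : ∀ cl κ → Traces cl (map erase κ) → WellLinked κ
  Traces⇒WellLinked cl κ (τ' , threads , gens) t =
    subst Chain (kinds-projL-erase t κ) (linked (projL t (map erase κ ++ τ')) refl)
    where
    τ = map erase κ
    linked : ∀ w → projL t (τ ++ τ') ≡ w → Chain (map kindₗ (projL t τ))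
    linked [] ττ'↾t≡[] =
      subst (Chain ∘ map kindₗ) (sym (++-conicalˡ _ _ (trans (sym (projL-++ t τ τ')) ττ'↾t≡[]))) tt
    linked (_ ∷ _) ττ'↾t≡w with All-threads⇒ (τ ++ τ') threads t (∷≢[] ∘ trans (sym ττ'↾t≡w))
    ... | i , refl = Closed-prefix (map kindₗ (projL t τ)) (map kindₗ (projL t τ'))
      (subst Closed (trans (cong (map kindₗ) (projL-++ t τ τ')) (map-++ kindₗ (projL t τ) (projL t τ')))
        (Gen⇒Closed (gens i)))

  Chain-projA-∷ : ∀ t x κ → Chain (map kind (projA t (x ∷ κ))) → Chain (map kind (projA t κ))
  Chain-projA-∷ t (t' , a) κ ch with t ≟ t'
  ... | yes _ = Chain-tail _ _ ch
  ... | no  _ = ch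

  WellLinked-remove : ∀ P x Q → projA (proj₁ x) P ≡ [] → WellLinked (P ++ x ∷ Q) → WellLinked (P ++ Q)
  WellLinked-remove P x Q P↾x≡[] linked t =
    Chain-projA-∷ t x (P ++ Q) (subst (Chain ∘ map kind) (sym (projA-move-front P x Q P↾x≡[] t)) (linked t))

  Chain-around : ∀ P x Q → WellLinked (P ++ x ∷ Q) →
    Chain (map kind (projA (proj₁ x) P) ++ kind x ∷ map kind (projA (proj₁ x) Q))
  Chain-around P x Q linked = subst Chain
    (trans (cong (map kind) (projA-middle P x Q)) (map-++ kind (projA (proj₁ x) P) (x ∷ projA (proj₁ x) Q)))
    (linked (proj₁ x))

  All-projA : ∀ {Q : AAct → Set} t κ → All (λ a → proj₁ a ≡ t → Q a) κ → All Q (projA t κ)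
  All-projA t []             []          = []
  All-projA t ((t' , a) ∷ κ) (Qa ∷ Qκ) with t ≟ t'
  ... | yes t≡t' = Qa (sym t≡t') ∷ All-projA t κ Qκ
  ... | no  _    = All-projA t κ Qκ

  -- Within a thread a command never directly follows a call, so a command is not preceded by
  -- pending calls of its own thread; likewise a return is not preceded by commands of its thread.
  no-calls-before-cmd : ∀ P x Q → WellLinked (P ++ x ∷ Q) → kind x ≡ cmd →
    All (λ a → proj₁ a ≡ proj₁ x → kind a ≡ call) P → projA (proj₁ x) P ≡ []
  no-calls-before-cmd P x Q linked x-cmd P-calls = map-≡-[] kind _
    (Chain-calls-before _ _ _ (Chain-around P x Q linked) (map⁺ (All-projA (proj₁ x) P P-calls)) λ x-ret →
      cmd≢ret (trans (sym x-cmd) x-ret))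
    where
    cmd≢ret : cmd ≢ ret
    cmd≢ret ()

  no-cmds-before-ret : ∀ P x Q → WellLinked (P ++ x ∷ Q) → kind x ≡ ret →
    All (λ a → proj₁ a ≡ proj₁ x → kind a ≡ cmd) P → projA (proj₁ x) P ≡ []
  no-cmds-before-ret P x Q linked x-ret P-cmds = map-≡-[] kind _
    (Chain-cmds-before-ret _ _ (subst (λ k → Chain (map kind (projA (proj₁ x) P) ++ k ∷ map kind (projA (proj₁ x) Q))) x-ret
        (Chain-around P x Q linked))
      (map⁺ (All-projA (proj₁ x) P P-cmds)))

  ⊑H⇒≼ : ∀ {H H'} → H ⊑H H' → H ≼ H'
  ⊑H⇒≼ {H} {H'} H⊑H' = subst₂ _≼_ (tabulate-lookup H) (tabulate-lookup H') (reindexing⇒≼ (record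
    { to         = Bijection.to ρ
    ; injective  = λ _ _ → Bijection.injective ρ
    ; surjective = Bijection.strictlySurjective ρ
    ; pres       = pres
    ; order      = order
    }))
    where open _⊑H_ H⊑H'

  projA≡⇒projL≡ : ∀ t {κ₁ κ₂} → projA t κ₁ ≡ projA t κ₂ → projL t (map erase κ₁) ≡ projL t (map erase κ₂)
  projA≡⇒projL≡ t {κ₁} {κ₂} eq =
    trans (projL-erase t κ₁) (trans (cong (map (unannotate ∘ proj₂)) eq) (sym (projL-erase t κ₂)))

  unrelated⇒cmds : ∀ h P → All (λ a → ¬ MustPrecede a h) (history P) →
    All (λ a → proj₁ a ≡ proj₁ h → kind a ≡ cmd) P
  unrelated⇒cmds h []                    _          = []
  unrelated⇒cmds h ((t , acmd c)    ∷ P) unrel      = (λ _ → refl) ∷ unrelated⇒cmds h P unrel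
  unrelated⇒cmds h ((t , acall m σ) ∷ P) (¬a ∷ unrel) = (λ t≡ → ⊥-elim (¬a (inj₁ t≡))) ∷ unrelated⇒cmds h P unrel
  unrelated⇒cmds h ((t , aret m σ)  ∷ P) (¬a ∷ unrel) = (λ t≡ → ⊥-elim (¬a (inj₁ t≡))) ∷ unrelated⇒cmds h P unrel

  Balanced-∷ : ∀ {l} h {H} → Balanced l (h ∷ H) → ∃ λ l₁ → BalStep l (proj₂ h) l₁ × Balanced l₁ H
  Balanced-∷ _ (r , l₁ , st , bal) = l₁ , st , r , bal

  frame-step : ∀ {t c s s₁ r u P} → f t c s ≡ ok P → P s₁ → s * r ≡ just u →
    ∃ λ u₁ → s₁ * r ≡ just u₁ × (∃ λ Q → f t c u ≡ ok Q × Q u₁) × u₁ ≈δ u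
  frame-step {t} {c} {s} {s₁} {r} {u} {P} fs Ps₁ sr
    with strong-locality t c s r u P sr fs
  ... | Q , fu , Q⇔ = u₁ , s₁r , (Q , fu , Qu₁) , footprint-preservation t c u Q u₁ fu Qu₁
    where
    s₁r′ = Equivalence.from (footprint-preservation t c s P s₁ fs Ps₁ r) (u , sr)
    u₁ = proj₁ s₁r′
    s₁r = proj₂ s₁r′
    Qu₁ = Equivalence.from (Q⇔ u₁) (s₁ , Ps₁ , s₁r)

  module Replaying (Γ : MSpec) where
    open Triple
    open Lifted SA
    open import Algebra.Solver.CommutativeMonoid ⊗-commutativeMonoid using (solve; _⊕_; _⊜_)
    open import Algebra.Properties.CommutativeSemigroup
      (CommutativeMonoid.commutativeSemigroup ⊗-commutativeMonoid) using (x∙yz≈y∙xz)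

    Reach⇒erase : ∀ {s τ s' κ} → Reach Γ s τ s' κ → τ ≡ map erase κ
    Reach⇒erase r-nil                        = refl
    Reach⇒erase (r-cons (s-cmd _ _)    r) = cong (_ ∷_) (Reach⇒erase r)
    Reach⇒erase (r-cons (s-call _ _ _) r) = cong (_ ∷_) (Reach⇒erase r)
    Reach⇒erase (r-cons (s-ret _ _ _)  r) = cong (_ ∷_) (Reach⇒erase r)

    -- A call the original run has already made but the replay has not yet performed.
    record PendingCall : Set₁ where
      field
        thread  : ℕ
        method  : Method
        σp      : St
        spec    : Triple
        spec-of : Γ method ≡ just spec
        pre     : p spec thread σp
    open PendingCall using (thread; method; σp)

    callAct : PendingCall → AAct
    callAct c = thread c , acall (method c) (σp c)

    callEvent : PendingCall → HAct
    callEvent c = thread c , icall (method c) (σp c)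

    history-callActs : ∀ cs → history (map callAct cs) ≡ map callEvent cs
    history-callActs []       = refl
    history-callActs (c ∷ cs) = cong (_ ∷_) (history-callActs cs)

    nonInterface-callActs : ∀ cs → nonInterface (map callAct cs) ≡ []
    nonInterface-callActs []       = refl
    nonInterface-callActs (c ∷ cs) = nonInterface-callActs cs

    -- The not yet replayed suffix of the original run; `returned` marks a return that the replay
    -- has already performed ahead of its turn, so its resource σq is already part of the replay state.
    data Run : St → Set₁ where
      stop     : ∀ {s} → Run s
      step     : ∀ {s s₁ a α} → Step Γ s a s₁ α → Run s₁ → Run s
      returned : ∀ {s s₁ t m sp σq} → Γ m ≡ just sp → q sp t σq → s * σq ≡ just s₁ → Run s₁ → Run s

    actions : ∀ {s} → Run s → List AAct
    actions stop                   = []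
    actions (step {α = α} _ R)     = α ∷ actions R
    actions (returned _ _ _ R)     = actions R

    returnedResources : ∀ {s} → Run s → List St
    returnedResources stop                             = []
    returnedResources (step _ R)                       = returnedResources R
    returnedResources (returned {σq = σq} _ _ _ R)     = σq ∷ returnedResources R

    -- weight R + (number of pending calls) drops at every replay step: postponing a call turns a
    -- step (3) into a pending call (1), an early return turns a step (3) into `returned` (1).
    weight : ∀ {s} → Run s → ℕ
    weight stop               = 0
    weight (step _ R)         = 3 + weight R
    weight (returned _ _ _ R) = 1 + weight R

    Todo : ∀ {s} → List PendingCall → Run s → List AAct
    Todo cs R = map callAct cs ++ actions R

    Todo-++ : ∀ {s} cs cs' (R : Run s) → Todo (cs ++ cs') R ≡ map callAct cs ++ Todo cs' R
    Todo-++ cs cs' R = trans (cong (_++ actions R) (map-++ callAct cs cs')) (++-assoc (map callAct cs) _ (actions R))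

    Framed : ∀ {s} → St → Run s → List PendingCall → Set
    Framed {s} u R cs = just u ≡ just s ⊗ (∏ (map σp cs) ⊗ ∏ (returnedResources R))

    ∏σp-++-∷ : ∀ Fa c Fb → ∏ (map σp (Fa ++ c ∷ Fb)) ≡ just (σp c) ⊗ ∏ (map σp (Fa ++ Fb))
    ∏σp-++-∷ Fa c Fb = begin
      ∏ (map σp (Fa ++ c ∷ Fb))                 ≡⟨ cong ∏ (map-++ σp Fa (c ∷ Fb)) ⟩
      ∏ (map σp Fa ++ σp c ∷ map σp Fb)         ≡⟨ ∏-++-∷ (map σp Fa) (σp c) (map σp Fb) ⟩
      just (σp c) ⊗ ∏ (map σp Fa ++ map σp Fb)  ≡⟨ cong (λ as → just (σp c) ⊗ ∏ as) (sym (map-++ σp Fa Fb)) ⟩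
      just (σp c) ⊗ ∏ (map σp (Fa ++ Fb))       ∎
      where open ≡-Reasoning

    Framed-call : ∀ {s u} (R : Run s) Fa c Fb → Framed u R (Fa ++ c ∷ Fb) →
      ∃ λ u₀ → σp c * u₀ ≡ just u × Framed u₀ R (Fa ++ Fb)
    Framed-call {s} {u} R Fa c Fb framed = proj₁ rest , σpu₀ , sym (proj₂ rest)
      where
      F = ∏ (map σp (Fa ++ Fb))
      E = ∏ (returnedResources R)
      u≡ : just u ≡ just (σp c) ⊗ (just s ⊗ (F ⊗ E))
      u≡ = begin
        just u                                     ≡⟨ framed ⟩
        just s ⊗ (∏ (map σp (Fa ++ c ∷ Fb)) ⊗ E)   ≡⟨ cong (λ P → just s ⊗ (P ⊗ E)) (∏σp-++-∷ Fa c Fb) ⟩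
        just s ⊗ ((just (σp c) ⊗ F) ⊗ E)           ≡⟨ solve 4 (λ a b c d → a ⊕ ((b ⊕ c) ⊕ d) ⊜ b ⊕ (a ⊕ (c ⊕ d))) refl (just s) (just (σp c)) F E ⟩
        just (σp c) ⊗ (just s ⊗ (F ⊗ E))           ∎
        where open ≡-Reasoning
      rest = ⊗-definedʳ (just (σp c)) (just s ⊗ (F ⊗ E)) (sym u≡)
      σpu₀ : σp c * proj₁ rest ≡ just u
      σpu₀ = trans (cong (just (σp c) ⊗_) (sym (proj₂ rest))) (sym u≡)

    Framed-delay : ∀ {s s₁ u a α} (st : Step Γ s a s₁ α) (R : Run s₁) cs c → σp c * s₁ ≡ just s →
      Framed u (step st R) cs → Framed u R (cs ++ c ∷ [])
    Framed-delay {s} {s₁} {u} st R cs c σps₁ framed = begin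
      just u                                     ≡⟨ framed ⟩
      just s ⊗ (F ⊗ E)                           ≡⟨ cong (_⊗ (F ⊗ E)) (sym σps₁) ⟩
      (just (σp c) ⊗ just s₁) ⊗ (F ⊗ E)          ≡⟨ solve 4 (λ a b c d → (a ⊕ b) ⊕ (c ⊕ d) ⊜ b ⊕ ((a ⊕ c) ⊕ d)) refl (just (σp c)) (just s₁) F E ⟩
      just s₁ ⊗ ((just (σp c) ⊗ F) ⊗ E)          ≡⟨ cong (λ P → just s₁ ⊗ (P ⊗ E)) (sym ∏-snoc) ⟩
      just s₁ ⊗ (∏ (map σp (cs ++ c ∷ [])) ⊗ E)  ∎
      where
      open ≡-Reasoning
      F = ∏ (map σp cs)
      E = ∏ (returnedResources R)
      ∏-snoc : ∏ (map σp (cs ++ c ∷ [])) ≡ just (σp c) ⊗ F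
      ∏-snoc = trans (∏σp-++-∷ cs c []) (cong (λ cs → just (σp c) ⊗ ∏ (map σp cs)) (++-identityʳ cs))

    Framed-returned : ∀ {s s₁ t m sp σq u} (spec-of : Γ m ≡ just sp) (post : q sp t σq)
      (sσq : s * σq ≡ just s₁) (R : Run s₁) cs → Framed u (returned spec-of post sσq R) cs → Framed u R cs
    Framed-returned {s} {s₁} {σq = σq} {u} _ _ sσq R cs framed = begin
      just u                          ≡⟨ framed ⟩
      just s ⊗ (F ⊗ (just σq ⊗ E))    ≡⟨ solve 4 (λ a b c d → a ⊕ (b ⊕ (c ⊕ d)) ⊜ (a ⊕ c) ⊕ (b ⊕ d)) refl (just s) F (just σq) E ⟩
      (just s ⊗ just σq) ⊗ (F ⊗ E)    ≡⟨ cong (_⊗ (F ⊗ E)) sσq ⟩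
      just s₁ ⊗ (F ⊗ E)               ∎
      where
      open ≡-Reasoning
      F = ∏ (map σp cs)
      E = ∏ (returnedResources R)

    Framed-return : ∀ {s u u₁ σq} (R R' : Run s) cs → Framed u R cs → u * σq ≡ just u₁ →
      ∏ (returnedResources R') ≡ just σq ⊗ ∏ (returnedResources R) → Framed u₁ R' cs
    Framed-return {s} {u} {u₁} {σq} R R' cs framed uσq returned'≡ = begin
      just u₁                                   ≡⟨ sym uσq ⟩
      just u ⊗ just σq                          ≡⟨ cong (_⊗ just σq) framed ⟩
      (just s ⊗ (F ⊗ E)) ⊗ just σq              ≡⟨ solve 4 (λ a b c d → (a ⊕ (b ⊕ c)) ⊕ d ⊜ a ⊕ (b ⊕ (d ⊕ c))) refl (just s) F E (just σq) ⟩
      just s ⊗ (F ⊗ (just σq ⊗ E))              ≡⟨ cong (λ E → just s ⊗ (F ⊗ E)) (sym returned'≡) ⟩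
      just s ⊗ (F ⊗ ∏ (returnedResources R'))   ∎
      where
      open ≡-Reasoning
      F = ∏ (map σp cs)
      E = ∏ (returnedResources R)

    Framed-cmd : ∀ {s s₁ t c P u} (fs : f t c s ≡ ok P) (Ps₁ : P s₁) (R : Run s₁) cs →
      Framed u (step (s-cmd fs Ps₁) R) cs →
      ∃ λ u₁ → Step Γ u (t , lc c) u₁ (t , acmd c) × Framed u₁ R cs × u₁ ≈δ u
    Framed-cmd {s} {s₁} fs Ps₁ R cs framed
      with ⊗-definedʳ (just s) (∏ (map σp cs) ⊗ ∏ (returnedResources R)) (sym framed)
    ... | r , F≡r with frame-step fs Ps₁ (trans (cong (just s ⊗_) (sym F≡r)) (sym framed))
    ... | u₁ , s₁r , (_ , fu , Qu₁) , u₁≈u = u₁ , s-cmd fu Qu₁ , sym (trans (cong (just s₁ ⊗_) F≡r) s₁r) , u₁≈u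

    record Replay (u : St) (Hr : History) (W : List AAct) : Set₁ where
      field
        acts          : List AAct
        labels        : List Act
        final         : St
        reaches       : Reach Γ u labels final acts
        history≡      : history acts ≡ Hr
        projA≡        : ∀ t → projA t acts ≡ projA t W
        nonInterface≡ : nonInterface acts ≡ nonInterface W

    replay-[] : ∀ u → Replay u [] []
    replay-[] u = record
      { acts = [] ; labels = [] ; final = u ; reaches = r-nil
      ; history≡ = refl ; projA≡ = λ _ → refl ; nonInterface≡ = refl }

    replay-∷ : ∀ {u a u₁ H₁} P x Q → Step Γ u a u₁ x → projA (proj₁ x) P ≡ [] →
      nonInterface (x ∷ P ++ Q) ≡ nonInterface (P ++ x ∷ Q) →
      Replay u₁ H₁ (P ++ Q) → Replay u (history (x ∷ []) ++ H₁) (P ++ x ∷ Q)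
    replay-∷ P x Q st P↾x≡[] nonInterface-moves ρ = record
      { acts          = x ∷ acts
      ; labels        = _ ∷ labels
      ; final         = final
      ; reaches       = r-cons st reaches
      ; history≡      = trans (history-++ (x ∷ []) acts) (cong (history (x ∷ []) ++_) history≡)
      ; projA≡        = λ t → trans (projA-∷-cong t x (projA≡ t)) (projA-move-front P x Q P↾x≡[] t)
      ; nonInterface≡ = trans (nonInterface-++ (x ∷ []) acts)
          (trans (cong (nonInterface (x ∷ []) ++_) nonInterface≡)
            (trans (sym (nonInterface-++ (x ∷ []) (P ++ Q))) nonInterface-moves))
      }
      where open Replay ρ

    record ExtractedReturn {s} (R : Run s) (A₂ B : History) (t : ℕ) (m : Method) (σq : St) : Set₁ where
      field
        R'          : Run s
        N₁ N₂       : List AAct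
        actions≡    : actions R ≡ N₁ ++ (t , aret m σq) ∷ N₂
        actions'≡   : actions R' ≡ N₁ ++ N₂
        history-N₁  : history N₁ ≡ A₂
        history-N₂  : history N₂ ≡ B
        returned'≡  : ∏ (returnedResources R') ≡ just σq ⊗ ∏ (returnedResources R)
        weight≡     : weight R ≡ 2 + weight R'
        spec        : Triple
        spec-of     : Γ m ≡ just spec
        post        : q spec t σq

    extract-under-step : ∀ {s s₁ a α A₂ B t m σq} (st : Step Γ s a s₁ α) {R : Run s₁} →
      ExtractedReturn R A₂ B t m σq → ExtractedReturn (step st R) (history (α ∷ []) ++ A₂) B t m σq
    extract-under-step {α = α} st ex = record
      { R' = step st R' ; N₁ = α ∷ N₁ ; N₂ = N₂
      ; actions≡ = cong (α ∷_) actions≡ ; actions'≡ = cong (α ∷_) actions'≡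
      ; history-N₁ = trans (history-++ (α ∷ []) N₁) (cong (history (α ∷ []) ++_) history-N₁)
      ; history-N₂ = history-N₂ ; returned'≡ = returned'≡ ; weight≡ = cong (3 +_) weight≡
      ; spec = spec ; spec-of = spec-of ; post = post }
      where open ExtractedReturn ex

    extract-return : ∀ {s} (R : Run s) A₂ B t m σq → history (actions R) ≡ A₂ ++ (t , iret m σq) ∷ B →
      ExtractedReturn R A₂ B t m σq
    extract-return stop A₂ B t m σq eq = ⊥-elim (++-∷-≢-[] A₂ _ B (sym eq))
    extract-return (returned {σq = σq'} spec-of' post' sσq' R) A₂ B t m σq eq = record
      { R' = returned spec-of' post' sσq' R' ; N₁ = N₁ ; N₂ = N₂
      ; actions≡ = actions≡ ; actions'≡ = actions'≡ ; history-N₁ = history-N₁ ; history-N₂ = history-N₂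
      ; returned'≡ = trans (cong (just σq' ⊗_) returned'≡) (x∙yz≈y∙xz (just σq') (just σq) (∏ (returnedResources R)))
      ; weight≡ = cong suc weight≡ ; spec = spec ; spec-of = spec-of ; post = post }
      where open ExtractedReturn (extract-return R A₂ B t m σq eq)
    extract-return (step st@(s-cmd _ _) R) A₂ B t m σq eq =
      extract-under-step st (extract-return R A₂ B t m σq eq)
    extract-return (step (s-call _ _ _) R) [] B t m σq ()
    extract-return (step st@(s-call _ _ _) R) (a ∷ A₂) B t m σq eq with ∷-injectiveˡ eq
    ... | refl = extract-under-step st (extract-return R A₂ B t m σq (∷-injectiveʳ eq))
    extract-return (step (s-ret spec-of post sσq) R) [] B t m σq refl = record
      { R' = returned spec-of post sσq R ; N₁ = [] ; N₂ = actions R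
      ; actions≡ = refl ; actions'≡ = refl ; history-N₁ = refl ; history-N₂ = refl
      ; returned'≡ = refl ; weight≡ = refl ; spec = _ ; spec-of = spec-of ; post = post }
    extract-return (step st@(s-ret _ _ _) R) (a ∷ A₂) B t m σq eq with ∷-injectiveˡ eq
    ... | refl = extract-under-step st (extract-return R A₂ B t m σq (∷-injectiveʳ eq))

    pending-calls-unrelated : ∀ h cs → All (λ a → ¬ MustPrecede a h) (map callEvent cs) →
      projA (proj₁ h) (map callAct cs) ≡ []
    pending-calls-unrelated h []       _            = refl
    pending-calls-unrelated h (c ∷ cs) (¬c ∷ unrel) with proj₁ h ≟ thread c
    ... | yes t≡ = ⊥-elim (¬c (inj₁ (sym t≡)))
    ... | no  _  = pending-calls-unrelated h cs unrel

    callActs-are-calls : ∀ t cs → All (λ a → proj₁ a ≡ t → kind a ≡ call) (map callAct cs)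
    callActs-are-calls t []       = []
    callActs-are-calls t (c ∷ cs) = (λ _ → refl) ∷ callActs-are-calls t cs

    measure : ∀ {s} → Run s → List PendingCall → ℕ
    measure R cs = weight R + length cs

    fuel-decreases : ∀ {m m' n} → m' < m → m < suc n → m' < n
    fuel-decreases m'<m (s≤s m≤n) = <-≤-trans m'<m m≤n

    record Invariant (n : ℕ) {s} (R : Run s) (cs : List PendingCall) (u l : St) (Hr : History) : Set₁ where
      field
        bounded  : measure R cs < n
        framed   : Framed u R cs
        disjoint : Defined (u * l)
        balanced : Balanced l Hr
        reorders : history (Todo cs R) ≼ Hr
        linked   : WellLinked (Todo cs R)

    -- The next event h of the target history is either a pending call, a return of the
    -- original run (performed ahead of its turn), or neither: then the head of the run can go first.
    data Quiet (cs : List PendingCall) {s} (R : Run s) : History → Set where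
      finished   : history (Todo cs R) ≡ [] → Quiet cs R []
      later-call : ∀ {t m σp H₁} A₂ B → history (actions R) ≡ A₂ ++ (t , icall m σp) ∷ B →
                   All (λ a → ¬ MustPrecede a (t , icall m σp)) (history (map callAct cs) ++ A₂) →
                   Quiet cs R ((t , icall m σp) ∷ H₁)

    data NextEvent (cs : List PendingCall) {s} (R : Run s) : History → Set where
      pending      : ∀ {h H₁} A B₁ → history (map callAct cs) ≡ A ++ h ∷ B₁ →
                     All (λ a → ¬ MustPrecede a h) A → (A ++ B₁ ++ history (actions R)) ≼ H₁ →
                     NextEvent cs R (h ∷ H₁)
      early-return : ∀ {t m σq H₁} A₂ B → history (actions R) ≡ A₂ ++ (t , iret m σq) ∷ B →
                     All (λ a → ¬ MustPrecede a (t , iret m σq)) (history (map callAct cs) ++ A₂) →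
                     ((history (map callAct cs) ++ A₂) ++ B) ≼ H₁ →
                     NextEvent cs R ((t , iret m σq) ∷ H₁)
      quiet        : ∀ {Hr} → Quiet cs R Hr → NextEvent cs R Hr

    next-event : ∀ cs {s} (R : Run s) {L Hr} → L ≼ Hr → L ≡ history (Todo cs R) → NextEvent cs R Hr
    next-event cs R [] []≡ = quiet (finished (sym []≡))
    next-event cs R (pull {A} {B} {h} unrel rel) L≡
      with split-++-∷ (history (map callAct cs)) (history (actions R)) A B h
             (trans (sym (history-++ (map callAct cs) (actions R))) (sym L≡))
    ... | inj₁ (B₁ , cs≡ , refl) = pending A B₁ cs≡ unrel rel
    ... | inj₂ (A₂ , refl , R≡) with h
    ...   | (t , iret m σq)  = early-return A₂ B R≡ unrel rel
    ...   | (t , icall m σp) = quiet (later-call A₂ B R≡ unrel)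

    replay : ∀ n {s} (R : Run s) cs {u l Hr} → Invariant n R cs u l Hr → Replay u Hr (Todo cs R)

    replay-call : ∀ n {s} (R : Run s) cs {u l h H₁} → Invariant (suc n) R cs u l (h ∷ H₁) →
      ∀ A B₁ → history (map callAct cs) ≡ A ++ h ∷ B₁ → All (λ a → ¬ MustPrecede a h) A →
      (A ++ B₁ ++ history (actions R)) ≼ H₁ → Replay u (h ∷ H₁) (Todo cs R)
    replay-call n R cs {u} {_} {_} {H₁} inv A B₁ cs≡ unrel rel
      with map-≡-++-∷ callEvent cs A _ B₁ (trans (sym (history-callActs cs)) cs≡)
    ... | Fa , c , Fb , refl , refl , refl , refl
      with Framed-call R Fa c Fb (Invariant.framed inv) | Balanced-∷ (callEvent c) (Invariant.balanced inv)
    ... | u₀ , σpu₀ , framed₀ | l₁ , comp , balanced₁ =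
      subst (Replay u _) (sym (Todo-++ Fa (c ∷ Fb) R))
        (replay-∷ (map callAct Fa) (callAct c) (Todo Fb R)
          (s-call (PendingCall.spec-of c) (PendingCall.pre c) σpu₀) Fa↾t≡[]
          (nonInterface-move-front (map callAct Fa) (callAct c) (Todo Fb R) (inj₁ refl))
          (subst (Replay u₀ H₁) (Todo-++ Fa Fb R) (replay n R (Fa ++ Fb) inv')))
      where
      open Invariant inv
      Fa↾t≡[] : projA (thread c) (map callAct Fa) ≡ []
      Fa↾t≡[] = pending-calls-unrelated (callEvent c) Fa unrel
      history-rest : history (Todo (Fa ++ Fb) R) ≡ map callEvent Fa ++ map callEvent Fb ++ history (actions R)
      history-rest = trans (history-++ (map callAct (Fa ++ Fb)) (actions R))
        (trans (cong (_++ history (actions R)) (trans (history-callActs (Fa ++ Fb)) (map-++ callEvent Fa Fb)))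
          (++-assoc (map callEvent Fa) (map callEvent Fb) (history (actions R))))
      inv' : Invariant n R (Fa ++ Fb) u₀ l₁ H₁
      inv' = record
        { bounded  = fuel-decreases (+-monoʳ-< (weight R) (≤-reflexive (sym (length-++-sucʳ Fa c Fb)))) bounded
        ; framed   = framed₀
        ; disjoint = Comp-frame disjoint comp σpu₀
        ; balanced = balanced₁
        ; reorders = subst (_≼ H₁) (sym history-rest) rel
        ; linked   = subst WellLinked (sym (Todo-++ Fa Fb R))
            (WellLinked-remove (map callAct Fa) (callAct c) (Todo Fb R) Fa↾t≡[]
              (subst WellLinked (Todo-++ Fa (c ∷ Fb) R) linked))
        }

    replay-return : ∀ n {s} (R : Run s) cs {u l t m σq H₁} → Invariant (suc n) R cs u l ((t , iret m σq) ∷ H₁) →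
      ∀ A₂ B → history (actions R) ≡ A₂ ++ (t , iret m σq) ∷ B →
      All (λ a → ¬ MustPrecede a (t , iret m σq)) (history (map callAct cs) ++ A₂) →
      ((history (map callAct cs) ++ A₂) ++ B) ≼ H₁ → Replay u ((t , iret m σq) ∷ H₁) (Todo cs R)
    replay-return n R cs {u} {_} {t} {m} {σq} {H₁} inv A₂ B R≡ unrel rel
      with Balanced-∷ (t , iret m σq) (Invariant.balanced inv)
    ... | l₁ , sub , balanced₁ with Sub-frame (Invariant.disjoint inv) sub
    ... | u₁ , uσq , disjoint₁ =
      subst (Replay u _) (sym Todo≡)
        (replay-∷ P x N₂ (s-ret spec-of post uσq) P↾t≡[] (nonInterface-move-front P x N₂ (inj₁ refl))
          (subst (Replay u₁ H₁) Todo'≡ (replay n R' cs inv')))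
      where
      open Invariant inv
      open ExtractedReturn (extract-return R A₂ B t m σq R≡)
      x = t , aret m σq
      P = map callAct cs ++ N₁
      Todo≡ : Todo cs R ≡ P ++ x ∷ N₂
      Todo≡ = trans (cong (map callAct cs ++_) actions≡) (sym (++-assoc (map callAct cs) N₁ (x ∷ N₂)))
      Todo'≡ : Todo cs R' ≡ P ++ N₂
      Todo'≡ = trans (cong (map callAct cs ++_) actions'≡) (sym (++-assoc (map callAct cs) N₁ N₂))
      history-P : history P ≡ history (map callAct cs) ++ A₂
      history-P = trans (history-++ (map callAct cs) N₁) (cong (history (map callAct cs) ++_) history-N₁)
      P↾t≡[] : projA t P ≡ []
      P↾t≡[] = no-cmds-before-ret P x N₂ (subst WellLinked Todo≡ linked) refl
        (unrelated⇒cmds (t , iret m σq) P (subst (All (λ a → ¬ MustPrecede a (t , iret m σq))) (sym history-P) unrel))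
      inv' : Invariant n R' cs u₁ l₁ H₁
      inv' = record
        { bounded  = fuel-decreases (subst (λ w → measure R' cs < w + length cs) (sym weight≡) (m<n+m _ {2} z<s)) bounded
        ; framed   = Framed-return R R' cs framed uσq returned'≡
        ; disjoint = disjoint₁
        ; balanced = balanced₁
        ; reorders = subst (_≼ H₁) (sym (trans (cong history Todo'≡)
            (trans (history-++ P N₂) (cong₂ _++_ history-P history-N₂)))) rel
        ; linked   = subst WellLinked (sym Todo'≡) (WellLinked-remove P x N₂ P↾t≡[] (subst WellLinked Todo≡ linked))
        }

    replay-cmd : ∀ n {s s₁ t c P} (fs : f t c s ≡ ok P) (Ps₁ : P s₁) (R : Run s₁) cs {u l Hr} →
      Invariant (suc n) (step (s-cmd fs Ps₁) R) cs u l Hr → Replay u Hr (Todo cs (step (s-cmd fs Ps₁) R))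
    replay-cmd n {t = t} {c} fs Ps₁ R cs {l = l} {Hr} inv with Framed-cmd fs Ps₁ R cs (Invariant.framed inv)
    ... | u₁ , cmd-step , framed₁ , u₁≈u =
      replay-∷ (map callAct cs) x (actions R) cmd-step cs↾t≡[]
        (nonInterface-move-front (map callAct cs) x (actions R) (inj₂ (nonInterface-callActs cs)))
        (replay n R cs inv')
      where
      open Invariant inv
      x = t , acmd c
      cs↾t≡[] : projA t (map callAct cs) ≡ []
      cs↾t≡[] = no-calls-before-cmd (map callAct cs) x (actions R) linked refl (callActs-are-calls t cs)
      inv' : Invariant n R cs u₁ l Hr
      inv' = record
        { bounded  = fuel-decreases (m<n+m _ {3} z<s) bounded
        ; framed   = framed₁
        ; disjoint = Equivalence.from (u₁≈u l) disjoint
        ; balanced = balanced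
        ; reorders = subst (_≼ Hr) (trans (history-++ (map callAct cs) (x ∷ actions R))
            (sym (history-++ (map callAct cs) (actions R)))) reorders
        ; linked   = WellLinked-remove (map callAct cs) x (actions R) cs↾t≡[] linked
        }

    replay-head : ∀ n {s} (R : Run s) cs {u l Hr} → Invariant (suc n) R cs u l Hr → Quiet cs R Hr →
      Replay u Hr (Todo cs R)
    replay-head n {s} stop cs {u} inv (finished done) =
      subst (λ cs → Replay u [] (Todo cs (stop {s}))) (sym cs≡[]) (replay-[] u)
      where
      cs≡[] : cs ≡ []
      cs≡[] = map-≡-[] callEvent cs (trans (sym (history-callActs cs))
        (++-conicalˡ _ [] (trans (sym (history-++ (map callAct cs) [])) done)))
    replay-head n stop cs inv (later-call A₂ B R≡ _) = ⊥-elim (++-∷-≢-[] A₂ _ B (sym R≡))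
    replay-head n (step (s-ret _ _ _) R) cs inv (finished done) =
      ⊥-elim (∷≢[] (++-conicalʳ (history (map callAct cs)) _ (trans (sym (history-++ (map callAct cs) _)) done)))
    replay-head n (step (s-ret _ _ _) R) cs inv (later-call [] B () _)
    replay-head n (step (s-ret _ _ _) R) cs inv (later-call (_ ∷ _) B R≡ unrel) with ∷-injectiveˡ R≡
    ... | refl with ++⁻ʳ (history (map callAct cs)) unrel
    ...   | ret-unrelated ∷ _ = ⊥-elim (ret-unrelated (inj₂ (tt , tt)))
    replay-head n (step (s-cmd fs Ps₁) R) cs inv _ = replay-cmd n fs Ps₁ R cs inv
    replay-head n (step st@(s-call {t} {m} {sp} {σp = σp'} spec-of pre σps₁) R) cs {u} {l} {Hr} inv _ =
      subst (Replay u Hr) (Todo-++ cs (c ∷ []) R) (replay n R (cs ++ c ∷ []) (record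
        { bounded  = fuel-decreases (subst (_< 3 + measure R cs) (sym measure-snoc) (m<n+m _ {2} z<s)) bounded
        ; framed   = Framed-delay st R cs c σps₁ framed
        ; disjoint = disjoint
        ; balanced = balanced
        ; reorders = subst (λ W → history W ≼ Hr) (sym (Todo-++ cs (c ∷ []) R)) reorders
        ; linked   = subst WellLinked (sym (Todo-++ cs (c ∷ []) R)) linked
        }))
      where
      open Invariant inv
      c : PendingCall
      c = record { thread = t ; method = m ; σp = σp' ; spec = sp ; spec-of = spec-of ; pre = pre }
      measure-snoc : measure R (cs ++ c ∷ []) ≡ suc (measure R cs)
      measure-snoc = trans (cong (weight R +_) (trans (length-++-sucʳ cs c []) (cong (suc ∘ length) (++-identityʳ cs))))
        (+-suc (weight R) (length cs))
    replay-head n (returned spec-of post sσq R) cs inv _ = replay n R cs (record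
      { bounded  = fuel-decreases (n<1+n _) bounded
      ; framed   = Framed-returned spec-of post sσq R cs framed
      ; disjoint = disjoint
      ; balanced = balanced
      ; reorders = reorders
      ; linked   = linked
      })
      where open Invariant inv

    replay zero R cs inv with Invariant.bounded inv
    ... | ()
    replay (suc n) R cs inv with next-event cs R (Invariant.reorders inv) refl
    ... | pending A B₁ cs≡ unrel rel      = replay-call n R cs inv A B₁ cs≡ unrel rel
    ... | early-return A₂ B R≡ unrel rel = replay-return n R cs inv A₂ B R≡ unrel rel
    ... | quiet qt                       = replay-head n R cs inv qt

    Reach⇒Run : ∀ {s τ s' κ} → Reach Γ s τ s' κ → Σ (Run s) λ R → actions R ≡ κ × returnedResources R ≡ []
    Reach⇒Run r-nil = stop , refl , refl
    Reach⇒Run (r-cons st r) with Reach⇒Run r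
    ... | R , refl , E≡[] = step st R , refl , E≡[]

    replay-run : ∀ {σ τ σ' κ l H'} → Reach Γ σ τ σ' κ → Defined (σ * l) → Balanced l H' →
      history κ ≼ H' → WellLinked κ → Replay σ H' κ
    replay-run {σ} reach σl balanced' reorders' linked' with Reach⇒Run reach
    ... | R , refl , E≡[] = replay (suc (measure R [])) R [] (record
      { bounded  = n<1+n _
      ; framed   = sym (trans (cong (λ E → just σ ⊗ (just e ⊗ ∏ E)) E≡[])
                     (trans (cong (just σ ⊗_) (⊗-identityˡ (just e))) (⊗-identityʳ (just σ))))
      ; disjoint = σl
      ; balanced = balanced'
      ; reorders = reorders'
      ; linked   = linked'
      })

lemma6p7 : (S : Setting) →
    let open Setting S
        open SepAlg SA
        open FpDefs SA
        open Sem S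
    in (Γ : MSpec) (cl : Client) (σ : St) (l : St) (H : History) (l' : St) (H' : History) →
       WFHistory H → WFHistory H' →
       Balanced l H → Balanced l' H' →
       (l , H) ⊑ (l' , H') →
       Γ ⊢ cl → Safe Γ cl σ →
       ∀ κ → InSem Γ cl σ κ → Defined (σ * l) → history κ ≡ H →
       ∃ λ κ' → InSem Γ cl σ κ' × (history κ' ≡ H') × (κ ∼ κ')
lemma6p7 S Γ cl σ l H l' H' _ _ _ balanced' (l'⪯l , H⊑H') _ _ κ (τ , _ , traces , reach) σl history≡H =
  acts , (labels , final , traces' , reaches) , history≡ , (λ t → sym (projA≡ t)) , sym nonInterface≡
  where
  open Sem S using (Traces; projL)
  open Lifted (Setting.SA S) using (⪯-frame)
  open Histories S
  open Replaying Γ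
  τ≡ : τ ≡ map erase κ
  τ≡ = Reach⇒erase reach
  replayed : Replay σ H' κ
  replayed = replay-run reach (⪯-frame σl l'⪯l) balanced' (subst (_≼ H') (sym history≡H) (⊑H⇒≼ H⊑H'))
    (Traces⇒WellLinked cl κ (subst (Traces cl) τ≡ traces))
  open Replay replayed
  traces' : Traces cl labels
  traces' = Traces-resp-projL cl (λ t → trans (cong (projL t) (Reach⇒erase reaches))
    (trans (projA≡⇒projL≡ t {acts} {κ} (projA≡ t)) (cong (projL t) (sym τ≡)))) traces
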